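{- Let $X=X_2$ with $|X|=1$. The four patterns $(((1,2),4),3)$, $(((1,3),2),4)$, $(((1,3),4),2)$ and $(((1,4),2),3)$ are Wilf equivalent to each other.
   Context: Binary trees are written as bracket expressions: a leaf is its label, and a tree whose root has left subtree $A$ and right subtree $B$ is written $(A,B)$. A tree with $l$ leaves is a planar binary rooted tree (single internal vertex label) with leaves labelled bijectively by $\{1,\dots,l\}$ so that, assigning to each internal vertex the minimum label of its descendant leaves, the left child of each internal vertex has a smaller assigned number than its right child. A subtree of $T$ is a subtree $S$ rooted at an internal vertex of $T$ such that for every internal vertex of $S$ both its children in $T$ are in $S$; its leaves carry the assigned integers and relabelling them order-preservingly by $1,\dots,l$ gives the standardisation $\mathrm{st}(S)$; $T$ avoids $P$ if $P\neq\mathrm{st}(S)$ for every subtree $S$. Patterns are Wilf equivalent if for every $l$ the numbers of trees with $l$ leaves avoiding them coincide. -}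

module Defs where

open import Data.Nat using (ℕ; zero; suc; _<_; _⊓_)
open import Data.Nat.Properties using (_<?_)
open import Data.List using (List; []; _∷_; _++_; map; upTo; length; filter)
open import Data.List.Relation.Binary.Permutation.Propositional using (_↭_)
open import Data.List.Relation.Unary.Unique.Propositional using (Unique)
open import Data.List.Membership.Propositional using (_∈_)
open import Data.Product using (Σ; _×_; ∃-syntax)
open import Function.Bundles using (_⇔_)
open import Relation.Binary.PropositionalEquality using (_≡_)
open import Relation.Nullary using (¬_)
open import Data.Unit using (⊤)

-- Planar binary rooted trees with a single internal vertex label (X = X₂, |X| = 1),
-- leaves carrying natural-number labels.
data Tree : Set where
  leaf : ℕ → Tree
  node : Tree → Tree → Tree

leaves : Tree → List ℕ
leaves (leaf n)   = n ∷ []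
leaves (node a b) = leaves a ++ leaves b

-- the number assigned to a vertex: minimum label of its descendant leaves
minLeaf : Tree → ℕ
minLeaf (leaf n)   = n
minLeaf (node a b) = minLeaf a ⊓ minLeaf b

Ordered : Tree → Set
Ordered (leaf n)   = ⊤
Ordered (node a b) = Ordered a × Ordered b × (minLeaf a < minLeaf b)

IsTree : ℕ → Tree → Set
IsTree l T = Ordered T × (leaves T ↭ map suc (upTo l))

-- Cut T s : s is obtained from T by choosing a "top part" containing the root such that
-- every internal vertex of s has both its children in s; a leaf of s is a vertex v of T
-- and carries the number assigned to v (minimum label of leaves of T below v).
data Cut : Tree → Tree → Set where
  cutHere : ∀ {T} → Cut T (leaf (minLeaf T))
  cutNode : ∀ {A B a b} → Cut A a → Cut B b → Cut (node A B) (node a b)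

-- Sub T S : S is a subtree of T rooted at an internal vertex v of T (the root of S
-- is internal in S, i.e. both children of v are in S).
data Sub : Tree → Tree → Set where
  here  : ∀ {A B a b} → Cut A a → Cut B b → Sub (node A B) (node a b)
  left  : ∀ {A B S} → Sub A S → Sub (node A B) S
  right : ∀ {A B S} → Sub B S → Sub (node A B) S

relabel : (ℕ → ℕ) → Tree → Tree
relabel f (leaf n)   = leaf (f n)
relabel f (node a b) = node (relabel f a) (relabel f b)

st : Tree → Tree
st S = relabel (λ x → suc (length (filter (_<? x) (leaves S)))) S

Avoids : Tree → Tree → Set
Avoids P T = ∀ S → Sub T S → ¬ (P ≡ st S)

NumAvoiding : Tree → ℕ → ℕ → Set
NumAvoiding P l n =
  Σ (List Tree) λ xs → Unique xs × length xs ≡ n × (∀ T → (T ∈ xs) ⇔ (IsTree l T × Avoids P T))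

WilfEquivalent : Tree → Tree → Set
WilfEquivalent P Q = ∀ l → ∃[ n ] (NumAvoiding P l n × NumAvoiding Q l n)

p₁ p₂ p₃ p₄ : Tree
p₁ = node (node (node (leaf 1) (leaf 2)) (leaf 4)) (leaf 3)
p₂ = node (node (node (leaf 1) (leaf 3)) (leaf 2)) (leaf 4)
p₃ = node (node (node (leaf 1) (leaf 3)) (leaf 4)) (leaf 2)
p₄ = node (node (node (leaf 1) (leaf 4)) (leaf 2)) (leaf 3)

patterns : List Tree
patterns = p₁ ∷ p₂ ∷ p₃ ∷ p₄ ∷ []

-- An occurrence of a pattern (((1,·),·),·) in an ordered tree lives on a left spine: it is cut from
-- three consecutive right branches c, b, a of the spine (read bottom-up) and the part of the spine
-- below them, whose minimum is the spine leaf x and hence smaller than everything above it.  Its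
-- standardisation is therefore (((1,·),·),·) with the last three labels recording just the relative
-- order of the minima of c, b and a.  So a tree avoids such a pattern iff every branch does and along
-- every spine the sequence of branch minima has no three consecutive entries in the forbidden order.
-- Permuting the branches of every spine, recursively, either by reversal or by the permutation that
-- reverses the order of their minima, is an involution on trees with l leaves.  Reversal exchanges
-- (((1,2),4),3) with (((1,3),4),2) and (((1,4),2),3) with (((1,3),2),4); reversing the order of the
-- minima exchanges (((1,2),4),3) with (((1,4),2),3).

module Submission where

open import Defs
open import Data.Empty using (⊥)
open import Data.Unit using (⊤; tt)
open import Data.Nat using (ℕ; suc; _<_; _≤_; _⊔_; _+_; z≤n; s≤s)
open import Data.Nat.Properties
  using (_<?_; _≟_; <-cmp; ≤-reflexive; module ≤-Reasoning; <-irrefl; <-asym; <-trans; <⇒≤;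
         m≤n⇒m⊓n≡m; ≤∧≢⇒<; suc-injective;
         ≤-decTotalOrder; ≤-totalOrder; m⊔n≤m+n; m⊔n≤o⇒m≤o; m⊔n≤o⇒n≤o; +-suc; +-mono-≤)
open import Data.List
  using (List; []; _∷_; _++_; _∷ʳ_; map; concatMap; upTo; length; filter; reverse; zip; deduplicate)
open import Data.List.Properties
  using (filter-all; filter-none; filter-++; ++-identityʳ; length-map; length-++; length-upTo;
         length-reverse; reverse-++; reverse-involutive; reverse-map; unfold-reverse; ++-assoc;
         map-id-local; map-cong-local; map-∘)
open import Data.List.Relation.Unary.All as All using (All; []; _∷_)
import Data.List.Relation.Unary.All.Properties as All
open import Data.List.Relation.Unary.AllPairs using (AllPairs; []; _∷_)
open import Data.List.Relation.Unary.Any as Any using (here; there)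
import Data.List.Relation.Unary.Any.Properties as Any
open import Data.List.Relation.Unary.Unique.Propositional using (Unique)
import Data.List.Relation.Unary.Unique.Propositional.Properties as Unique
open import Data.List.Relation.Unary.Unique.DecPropositional.Properties using (deduplicate-!)
open import Data.List.Membership.Propositional using (_∈_)
open import Data.List.Membership.Propositional.Properties
  using (∈-++⁺ˡ; ∈-++⁺ʳ; ∈-map⁺; ∈-map⁻; ∈-concatMap⁺; ∈-filter⁺; ∈-filter⁻; ∈-deduplicate⁻;
         deduplicate-∈⇔; ∈-∃++)
open import Data.List.Membership.Propositional.Properties.WithK using (unique∧set⇒bag)
open import Data.List.Relation.Binary.BagAndSetEquality using (∼bag⇒↭)
open import Data.List.Relation.Binary.Permutation.Propositional
  using (_↭_; ↭-refl; ↭-sym; ↭-trans; prep; swap; ↭⇒↭ₛ; module PermutationReasoning)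
open import Data.List.Relation.Binary.Permutation.Propositional.Properties
  using (All-resp-↭; ∈-resp-↭; ↭-length; ↭-reverse; ++-comm; ++⁺ˡ; ++⁺ʳ; shifts; shift; drop-∷;
         ¬x∷xs↭[]; filter-↭)
import Data.List.Relation.Binary.Permutation.Propositional.Properties as Perm
import Data.List.Relation.Binary.Permutation.Setoid.Properties as PermSetoid
open import Data.List.Relation.Binary.Pointwise using (Pointwise-≡⇒≡)
import Data.List.Relation.Unary.Sorted.TotalOrder.Properties as Sorted
import Data.List.Sort ≤-decTotalOrder as Sort
open import Data.Product using (Σ; ∃; _×_; _,_; proj₁; proj₂)
open import Data.Product.Function.NonDependent.Propositional using (_×-⇔_)
open import Data.Sum using (_⊎_; inj₁; inj₂)
open import Function using (_∘_; id)
open import Function.Bundles using (_⇔_; mk⇔; Equivalence)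
open import Relation.Binary.Definitions using (DecidableEquality; tri<; tri≈; tri>)
open import Relation.Binary.PropositionalEquality
  using (_≡_; _≢_; refl; sym; trans; cong; cong₂; subst; setoid; ≢-sym; module ≡-Reasoning)
open import Relation.Nullary using (¬_; Dec; yes; no; _×-dec_; ¬?; map′; contradiction)
import Relation.Unary as Pred

open Equivalence using (to; from)

private
  variable
    A B : Set
    xs ys : List A

Unique-resp-↭ : xs ↭ ys → Unique xs → Unique ys
Unique-resp-↭ p = PermSetoid.Unique-resp-↭ (setoid _) (↭⇒↭ₛ p)

Unique-map⁺-on : (f : A → B) → Unique xs →
                 (∀ {a b} → a ∈ xs → b ∈ xs → f a ≡ f b → a ≡ b) → Unique (map f xs)
Unique-map⁺-on f []       _   = []
Unique-map⁺-on f (u ∷ us) inj =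
  All.map⁺ (All.tabulate λ b∈ e → All.lookup u b∈ (inj (here refl) (there b∈) e)) ∷
  Unique-map⁺-on f us (λ a∈ b∈ → inj (there a∈) (there b∈))

AllPairs-++⁻ : ∀ {R : A → A → Set} xs {ys} → AllPairs R (xs ++ ys) →
               AllPairs R xs × AllPairs R ys × (∀ {a b} → a ∈ xs → b ∈ ys → R a b)
AllPairs-++⁻ []       rs       = [] , rs , λ ()
AllPairs-++⁻ (x ∷ xs) (r ∷ rs) =
  let rxs , rys , across = AllPairs-++⁻ xs rs
  in All.++⁻ˡ xs r ∷ rxs , rys , λ { (here refl) b∈ → All.lookup r (∈-++⁺ʳ xs b∈)
                                   ; (there a∈)  b∈ → across a∈ b∈ }

concatMap-↭ : (f : A → List B) → xs ↭ ys → concatMap f xs ↭ concatMap f ys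
concatMap-↭ f _↭_.refl          = ↭-refl
concatMap-↭ f (prep x p)        = ++⁺ˡ (f x) (concatMap-↭ f p)
concatMap-↭ f (_↭_.swap x y p)  = ↭-trans (shifts (f x) (f y)) (++⁺ˡ (f y) (++⁺ˡ (f x) (concatMap-↭ f p)))
concatMap-↭ f (_↭_.trans p q)   = ↭-trans (concatMap-↭ f p) (concatMap-↭ f q)

↭-decidable : DecidableEquality A → (xs ys : List A) → Dec (xs ↭ ys)
↭-decidable _≟ᴬ_ []       []       = yes ↭-refl
↭-decidable _≟ᴬ_ []       (y ∷ ys) = no (¬x∷xs↭[] ∘ ↭-sym)
↭-decidable _≟ᴬ_ (x ∷ xs) ys with Any.any? (x ≟ᴬ_) ys
... | no  x∉ = no (λ p → x∉ (∈-resp-↭ p (here refl)))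
... | yes x∈ with ∈-∃++ x∈
...   | us , vs , refl with ↭-decidable _≟ᴬ_ xs (us ++ vs)
...     | yes p = yes (↭-trans (prep x p) (↭-sym (shift x us vs)))
...     | no ¬p = no (λ q → ¬p (drop-∷ (↭-trans q (shift x us vs))))

Counts : (A → Set) → ℕ → Set
Counts {A} P n = Σ (List A) λ as → Unique as × length as ≡ n × (∀ a → a ∈ as ⇔ P a)

counts-decidable : ∀ {P : A → Set} → DecidableEquality A → Pred.Decidable P →
                   (as : List A) → (∀ {a} → P a → a ∈ as) → ∃ (Counts P)
counts-decidable _≟ᴬ_ P? as complete =
  length bs , bs , deduplicate-! _≟ᴬ_ (filter P? as) , refl ,
  λ a → mk⇔ (λ a∈ → proj₂ (∈-filter⁻ P? {xs = as} (∈-deduplicate⁻ _≟ᴬ_ (filter P? as) a∈)))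
            (λ p → to (deduplicate-∈⇔ _≟ᴬ_) (∈-filter⁺ P? (complete p) p))
  where bs = deduplicate _≟ᴬ_ (filter P? as)

counts-involution : ∀ {P Q : A → Set} {n} (φ : A → A) →
                    (∀ {a} → P a → Q (φ a)) → (∀ {a} → Q a → P (φ a)) →
                    (∀ {a} → P a → φ (φ a) ≡ a) → (∀ {a} → Q a → φ (φ a) ≡ a) →
                    Counts P n → Counts Q n
counts-involution {Q = Q} φ P⇒Q Q⇒P φφ-P φφ-Q (as , u , len , mem) =
  map φ as , Unique-map⁺-on φ u injective , trans (length-map φ as) len ,
  λ a → mk⇔ (image⇒Q a) (λ q → subst (_∈ map φ as) (φφ-Q q) (∈-map⁺ φ (from (mem _) (Q⇒P q))))
  where
  injective : ∀ {a b} → a ∈ as → b ∈ as → φ a ≡ φ b → a ≡ b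
  injective a∈ b∈ e =
    trans (sym (φφ-P (to (mem _) a∈))) (trans (cong φ e) (φφ-P (to (mem _) b∈)))
  image⇒Q : ∀ a → a ∈ map φ as → Q a
  image⇒Q a a∈ with ∈-map⁻ φ a∈
  ... | b , b∈ , refl = P⇒Q (to (mem b) b∈)

-- Left spines

_≟ᵀ_ : DecidableEquality Tree
leaf m   ≟ᵀ leaf n with m ≟ n
... | yes refl = yes refl
... | no  m≢n  = no λ { refl → m≢n refl }
leaf _   ≟ᵀ node _ _ = no λ ()
node _ _ ≟ᵀ leaf _   = no λ ()
node a b ≟ᵀ node c d with a ≟ᵀ c | b ≟ᵀ d
... | yes refl | yes refl = yes refl
... | no  a≢c  | _        = no λ { refl → a≢c refl }
... | yes _    | no  b≢d  = no λ { refl → b≢d refl }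

WellLabelled : Tree → Set
WellLabelled T = Ordered T × Unique (leaves T)

IsTree⇒WellLabelled : ∀ {l T} → IsTree l T → WellLabelled T
IsTree⇒WellLabelled {l} (o , p) = o , Unique-resp-↭ (↭-sym p) (Unique.map⁺ suc-injective (Unique.upTo⁺ l))

WellLabelled-node⁻ : ∀ {A B} → WellLabelled (node A B) → WellLabelled A × WellLabelled B
WellLabelled-node⁻ {A} ((oA , oB , _) , u) =
  let uA , uB , _ = AllPairs-++⁻ (leaves A) u in (oA , uA) , (oB , uB)

minLeaf∈leaves : ∀ T → Ordered T → minLeaf T ∈ leaves T
minLeaf∈leaves (leaf _)   _              = here refl
minLeaf∈leaves (node A B) (oA , _ , A<B) rewrite m≤n⇒m⊓n≡m (<⇒≤ A<B) = ∈-++⁺ˡ (minLeaf∈leaves A oA)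

-- Right branches are listed from the root downwards.
spine : ℕ → List Tree → Tree
spine x []       = leaf x
spine x (b ∷ bs) = node (spine x bs) b

spineLeaf : Tree → ℕ
spineLeaf (leaf x)   = x
spineLeaf (node A _) = spineLeaf A

branches : Tree → List Tree
branches (leaf _)   = []
branches (node A B) = B ∷ branches A

spine-branches : ∀ T → spine (spineLeaf T) (branches T) ≡ T
spine-branches (leaf _)   = refl
spine-branches (node A B) = cong (λ T → node T B) (spine-branches A)

spineLeaf-spine : ∀ x bs → spineLeaf (spine x bs) ≡ x
spineLeaf-spine x []       = refl
spineLeaf-spine x (_ ∷ bs) = spineLeaf-spine x bs

branches-spine : ∀ x bs → branches (spine x bs) ≡ bs
branches-spine x []       = refl
branches-spine x (b ∷ bs) = cong (b ∷_) (branches-spine x bs)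

Above : ℕ → List Tree → Set
Above x = All ((x <_) ∘ minLeaf)

minLeaf-spine : ∀ x bs → Above x bs → minLeaf (spine x bs) ≡ x
minLeaf-spine x []       []         = refl
minLeaf-spine x (b ∷ bs) (x<b ∷ x<bs) rewrite minLeaf-spine x bs x<bs = m≤n⇒m⊓n≡m (<⇒≤ x<b)

Ordered-spine⁻ : ∀ x bs → Ordered (spine x bs) → All Ordered bs × Above x bs
Ordered-spine⁻ x []       _            = [] , []
Ordered-spine⁻ x (b ∷ bs) (o , ob , lt) =
  let obs , x<bs = Ordered-spine⁻ x bs o
  in ob ∷ obs , subst (_< minLeaf b) (minLeaf-spine x bs x<bs) lt ∷ x<bs

Ordered-spine⁺ : ∀ x bs → All Ordered bs → Above x bs → Ordered (spine x bs)
Ordered-spine⁺ x []       _          _            = tt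
Ordered-spine⁺ x (b ∷ bs) (ob ∷ obs) (x<b ∷ x<bs) =
  Ordered-spine⁺ x bs obs x<bs , ob , subst (_< minLeaf b) (sym (minLeaf-spine x bs x<bs)) x<b

leaves-spine : ∀ x bs → leaves (spine x bs) ↭ x ∷ concatMap leaves bs
leaves-spine x []       = ↭-refl
leaves-spine x (b ∷ bs) = begin
  leaves (spine x bs) ++ leaves b      ↭⟨ ++⁺ʳ (leaves b) (leaves-spine x bs) ⟩
  x ∷ (concatMap leaves bs ++ leaves b) ↭⟨ prep x (++-comm (concatMap leaves bs) (leaves b)) ⟩
  x ∷ (leaves b ++ concatMap leaves bs) ∎
  where open PermutationReasoning

ProperSpine : ℕ → List Tree → Set
ProperSpine x bs = All Ordered bs × Above x bs × Unique (x ∷ concatMap leaves bs)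

WellLabelled-spine : ∀ x bs → WellLabelled (spine x bs) ⇔ ProperSpine x bs
WellLabelled-spine x bs = mk⇔
  (λ (o , u) → let obs , x<bs = Ordered-spine⁻ x bs o
               in obs , x<bs , Unique-resp-↭ (leaves-spine x bs) u)
  (λ (obs , x<bs , u) → Ordered-spine⁺ x bs obs x<bs , Unique-resp-↭ (↭-sym (leaves-spine x bs)) u)

ProperSpine-↭ : ∀ {x bs cs} → bs ↭ cs → ProperSpine x bs → ProperSpine x cs
ProperSpine-↭ {x} p (obs , x<bs , u) =
  All-resp-↭ p obs , All-resp-↭ p x<bs , Unique-resp-↭ (prep x (concatMap-↭ leaves p)) u

Unique-minLeaves : ∀ bs → All Ordered bs → Unique (concatMap leaves bs) → Unique (map minLeaf bs)
Unique-minLeaves []       _          _ = []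
Unique-minLeaves (b ∷ bs) (ob ∷ obs) u =
  All.map⁺ (All.tabulate distinct) ∷ Unique-minLeaves bs obs ubs
  where
  ubs = proj₁ (proj₂ (AllPairs-++⁻ (leaves b) u))
  distinct : ∀ {c} → c ∈ bs → minLeaf b ≢ minLeaf c
  distinct {c} c∈ e = proj₂ (proj₂ (AllPairs-++⁻ (leaves b) u)) (minLeaf∈leaves b ob) minLeaf-b∈ refl
    where
    minLeaf-b∈ : minLeaf b ∈ concatMap leaves bs
    minLeaf-b∈ = ∈-concatMap⁺ leaves (Any.map (λ { refl →
      subst (_∈ leaves c) (sym e) (minLeaf∈leaves c (All.lookup obs c∈)) }) c∈)

Admissible : ℕ → List Tree → Set
Admissible x bs = Above x bs × Unique (map minLeaf bs)

ProperSpine⇒Admissible : ∀ {x bs} → ProperSpine x bs → Admissible x bs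
ProperSpine⇒Admissible {bs = bs} (obs , x<bs , _ ∷ u) = x<bs , Unique-minLeaves bs obs u

-- Occurrences and order types

comb : ℕ → ℕ → ℕ → ℕ → Tree
comb a b c d = node (node (node (leaf a) (leaf b)) (leaf c)) (leaf d)

comb-cong : ∀ {a b c d a′ b′ c′ d′} → a ≡ a′ → b ≡ b′ → c ≡ c′ → d ≡ d′ →
            comb a b c d ≡ comb a′ b′ c′ d′
comb-cong refl refl refl refl = refl

data IsComb : Tree → Set where
  isComb : ∀ a b c d → IsComb (comb a b c d)

relabel-IsComb⁻ : ∀ {P} f S → IsComb P → P ≡ relabel f S → IsComb S
relabel-IsComb⁻ f (node (node (node (leaf a) (leaf b)) (leaf c)) (leaf d)) _ _ = isComb a b c d
relabel-IsComb⁻ f (leaf _)                                            (isComb _ _ _ _) ()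
relabel-IsComb⁻ f (node (leaf _) _)                                   (isComb _ _ _ _) ()
relabel-IsComb⁻ f (node (node (leaf _) _) _)                          (isComb _ _ _ _) ()
relabel-IsComb⁻ f (node (node (node (node _ _) _) _) _)               (isComb _ _ _ _) ()
relabel-IsComb⁻ f (node (node (node (leaf _) (node _ _)) _) _)        (isComb _ _ _ _) ()
relabel-IsComb⁻ f (node (node (node (leaf _) (leaf _)) (node _ _)) _) (isComb _ _ _ _) ()
relabel-IsComb⁻ f (node (node (node (leaf _) (leaf _)) (leaf _)) (node _ _)) (isComb _ _ _ _) ()

-- The subtrees of shape (((·,·),·),·) rooted at node A B are exactly those cut at A = ((X,Y),Z) and B.
OccursAt : Tree → Tree → Tree → Set
OccursAt P (node (node X Y) Z) W = P ≡ st (comb (minLeaf X) (minLeaf Y) (minLeaf Z) (minLeaf W))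
OccursAt P _                   _ = ⊥

NoOccurrence : Tree → Tree → Set
NoOccurrence P (leaf _)   = ⊤
NoOccurrence P (node A B) = NoOccurrence P A × NoOccurrence P B × ¬ OccursAt P A B

OccursAt⇒Sub : ∀ P A B → OccursAt P A B → ∃ λ S → Sub (node A B) S × P ≡ st S
OccursAt⇒Sub P (node (node X Y) Z) W occ = _ , here (cutNode (cutNode cutHere cutHere) cutHere) cutHere , occ

Avoids⇒NoOccurrence : ∀ P T → Avoids P T → NoOccurrence P T
Avoids⇒NoOccurrence P (leaf _)   _      = tt
Avoids⇒NoOccurrence P (node A B) avoids =
  Avoids⇒NoOccurrence P A (λ S → avoids S ∘ left) ,
  Avoids⇒NoOccurrence P B (λ S → avoids S ∘ right) ,
  λ occ → let S , s , eq = OccursAt⇒Sub P A B occ in avoids S s eq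

NoOccurrence-Sub : ∀ {P T a b c d} → NoOccurrence P T → Sub T (comb a b c d) → P ≢ st (comb a b c d)
NoOccurrence-Sub {T = node A B} (_ , _ , ¬occ) (here (cutNode (cutNode cutHere cutHere) cutHere) cutHere) = ¬occ
NoOccurrence-Sub {T = node A B} (noA , _ , _) (left s)  = NoOccurrence-Sub noA s
NoOccurrence-Sub {T = node A B} (_ , noB , _) (right s) = NoOccurrence-Sub noB s

NoOccurrence⇒Avoids : ∀ {P} T → IsComb P → NoOccurrence P T → Avoids P T
NoOccurrence⇒Avoids T combP noOcc S s eq with relabel-IsComb⁻ _ S combP eq
... | isComb _ _ _ _ = NoOccurrence-Sub noOcc s eq

-- st relabels every leaf by its rank, so st (comb x y z w) unfolds to comb (rank L x) … (rank L w)
-- with L = x ∷ y ∷ z ∷ w ∷ [].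
rank : List ℕ → ℕ → ℕ
rank L v = suc (length (filter (_<? v) L))

rank-↭ : ∀ {L L′} v → L ↭ L′ → rank L v ≡ rank L′ v
rank-↭ v p = cong suc (↭-length (filter-↭ (_<? v) p))

rank-++ : ∀ {v} ls {hs} → All (_< v) ls → All (λ u → ¬ u < v) hs → rank (ls ++ hs) v ≡ suc (length ls)
rank-++ {v} ls {hs} below notBelow = cong suc (begin
  length (filter (_<? v) (ls ++ hs))              ≡⟨ cong length (filter-++ (_<? v) ls hs) ⟩
  length (filter (_<? v) ls ++ filter (_<? v) hs) ≡⟨ cong₂ (λ as bs → length (as ++ bs))
                                                       (filter-all (_<? v) below) (filter-none (_<? v) notBelow) ⟩
  length (ls ++ [])                               ≡⟨ cong length (++-identityʳ ls) ⟩
  length ls                                       ∎)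
  where open ≡-Reasoning

ranks-increasing : ∀ {L a b c d} → a < b → b < c → c < d → L ↭ a ∷ b ∷ c ∷ d ∷ [] →
                   rank L a ≡ 1 × rank L b ≡ 2 × rank L c ≡ 3 × rank L d ≡ 4
ranks-increasing {a = a} {b} {c} {d} a<b b<c c<d p =
  trans (rank-↭ a p) (rank-++ [] [] (<-irrefl refl ∷ <-asym a<b ∷ <-asym a<c ∷ <-asym a<d ∷ [])) ,
  trans (rank-↭ b p) (rank-++ (a ∷ []) (a<b ∷ []) (<-irrefl refl ∷ <-asym b<c ∷ <-asym b<d ∷ [])) ,
  trans (rank-↭ c p) (rank-++ (a ∷ b ∷ []) (a<c ∷ b<c ∷ []) (<-irrefl refl ∷ <-asym c<d ∷ [])) ,
  trans (rank-↭ d p) (rank-++ (a ∷ b ∷ c ∷ []) (a<d ∷ b<d ∷ c<d ∷ []) (<-irrefl refl ∷ []))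
  where
  a<c = <-trans a<b b<c
  b<d = <-trans b<c c<d
  a<d = <-trans a<c c<d

-- The order type of three distinct numbers y, z, w: the constructor lists them in increasing order.
data Shape : Set where
  yzw ywz zyw zwy wyz wzy : Shape

InOrder : Shape → ℕ → ℕ → ℕ → Set
InOrder yzw y z w = y < z × z < w
InOrder ywz y z w = y < w × w < z
InOrder zyw y z w = z < y × y < w
InOrder zwy y z w = z < w × w < y
InOrder wyz y z w = w < y × y < z
InOrder wzy y z w = w < z × z < y

patternOf : Shape → Tree
patternOf yzw = comb 1 2 3 4
patternOf ywz = comb 1 2 4 3
patternOf zyw = comb 1 3 2 4
patternOf zwy = comb 1 4 2 3
patternOf wyz = comb 1 3 4 2
patternOf wzy = comb 1 4 3 2

patternOf-IsComb : ∀ s → IsComb (patternOf s)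
patternOf-IsComb yzw = isComb _ _ _ _
patternOf-IsComb ywz = isComb _ _ _ _
patternOf-IsComb zyw = isComb _ _ _ _
patternOf-IsComb zwy = isComb _ _ _ _
patternOf-IsComb wyz = isComb _ _ _ _
patternOf-IsComb wzy = isComb _ _ _ _

-- A left inverse of patternOf, reading the labels of the second and third leaf.
shapeOf : Tree → Shape
shapeOf (node (node (node _ (leaf 2)) (leaf 3)) _) = yzw
shapeOf (node (node (node _ (leaf 2)) _)        _) = ywz
shapeOf (node (node (node _ (leaf 3)) (leaf 2)) _) = zyw
shapeOf (node (node (node _ (leaf 3)) _)        _) = wyz
shapeOf (node (node (node _ _)        (leaf 2)) _) = zwy
shapeOf _                                          = wzy

patternOf-injective : ∀ s s′ → patternOf s ≡ patternOf s′ → s ≡ s′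
patternOf-injective s s′ e = trans (shapeOf-patternOf s) (trans (cong shapeOf e) (sym (shapeOf-patternOf s′)))
  where
  shapeOf-patternOf : ∀ s → s ≡ shapeOf (patternOf s)
  shapeOf-patternOf yzw = refl
  shapeOf-patternOf ywz = refl
  shapeOf-patternOf zyw = refl
  shapeOf-patternOf zwy = refl
  shapeOf-patternOf wyz = refl
  shapeOf-patternOf wzy = refl

st-comb : ∀ s {x y z w} → x < y → x < z → x < w → InOrder s y z w → st (comb x y z w) ≡ patternOf s
st-comb yzw x<y _ _ (y<z , z<w) =
  let r₁ , r₂ , r₃ , r₄ = ranks-increasing x<y y<z z<w ↭-refl in comb-cong r₁ r₂ r₃ r₄
st-comb ywz {x} {y} {z} {w} x<y _ _ (y<w , w<z) =
  let r₁ , r₂ , r₃ , r₄ = ranks-increasing x<y y<w w<z (prep x (prep y (swap z w ↭-refl)))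
  in comb-cong r₁ r₂ r₄ r₃
st-comb zyw {x} {y} {z} {w} _ x<z _ (z<y , y<w) =
  let r₁ , r₂ , r₃ , r₄ = ranks-increasing x<z z<y y<w (prep x (swap y z ↭-refl))
  in comb-cong r₁ r₃ r₂ r₄
st-comb zwy {x} {y} {z} {w} _ x<z _ (z<w , w<y) =
  let r₁ , r₂ , r₃ , r₄ = ranks-increasing x<z z<w w<y
                            (prep x (↭-trans (swap y z ↭-refl) (prep z (swap y w ↭-refl))))
  in comb-cong r₁ r₄ r₂ r₃
st-comb wyz {x} {y} {z} {w} _ _ x<w (w<y , y<z) =
  let r₁ , r₂ , r₃ , r₄ = ranks-increasing x<w w<y y<z
                            (prep x (↭-trans (prep y (swap z w ↭-refl)) (swap y w ↭-refl)))
  in comb-cong r₁ r₃ r₄ r₂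
st-comb wzy {x} {y} {z} {w} _ _ x<w (w<z , z<y) =
  let r₁ , r₂ , r₃ , r₄ = ranks-increasing x<w w<z z<y
                            (prep x (↭-trans (swap y z ↭-refl)
                                            (↭-trans (prep z (swap y w ↭-refl)) (swap z w ↭-refl))))
  in comb-cong r₁ r₄ r₃ r₂

≢⇒<⊎> : ∀ {m n} → m ≢ n → m < n ⊎ n < m
≢⇒<⊎> {m} {n} m≢n with <-cmp m n
... | tri< m<n _ _ = inj₁ m<n
... | tri≈ _ m≡n _ = contradiction m≡n m≢n
... | tri> _ _ n<m = inj₂ n<m

InOrder-total : ∀ {y z w} → y ≢ z → z ≢ w → y ≢ w → ∃ λ s → InOrder s y z w
InOrder-total y≢z z≢w y≢w with ≢⇒<⊎> y≢z | ≢⇒<⊎> z≢w | ≢⇒<⊎> y≢w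
... | inj₁ y<z | inj₁ z<w | _        = yzw , y<z , z<w
... | inj₁ y<z | inj₂ w<z | inj₁ y<w = ywz , y<w , w<z
... | inj₁ y<z | inj₂ w<z | inj₂ w<y = wyz , w<y , y<z
... | inj₂ z<y | inj₁ z<w | inj₁ y<w = zyw , z<y , y<w
... | inj₂ z<y | inj₁ z<w | inj₂ w<y = zwy , z<w , w<y
... | inj₂ z<y | inj₂ w<z | _        = wzy , w<z , z<y

occurs⇔InOrder : ∀ s {x y z w} → x < y → x < z → x < w → y ≢ z → z ≢ w → y ≢ w →
                 patternOf s ≡ st (comb x y z w) ⇔ InOrder s y z w
occurs⇔InOrder s {x} {y} {z} {w} x<y x<z x<w y≢z z≢w y≢w = mk⇔ occurs⇒InOrder (sym ∘ st-comb s x<y x<z x<w)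
  where
  occurs⇒InOrder : patternOf s ≡ st (comb x y z w) → InOrder s y z w
  occurs⇒InOrder eq =
    let s′ , o = InOrder-total y≢z z≢w y≢w
    in subst (λ t → InOrder t y z w) (patternOf-injective s′ s (sym (trans eq (st-comb s′ x<y x<z x<w o)))) o

-- Entries are branch minima from the root downwards, so a triple a, b, c is tested bottom-up as R c b a.
NoConsecutive : (ℕ → ℕ → ℕ → Set) → List ℕ → Set
NoConsecutive R (a ∷ b ∷ c ∷ ks) = ¬ R c b a × NoConsecutive R (b ∷ c ∷ ks)
NoConsecutive R _                = ⊤

NoConsecutive⇔splits : ∀ R ks →
  NoConsecutive R ks ⇔ (∀ ls a b c hs → ks ≡ ls ++ a ∷ b ∷ c ∷ hs → ¬ R c b a)
NoConsecutive⇔splits R ks =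
  mk⇔ (λ nc ls a b c hs e → splits ls a b c hs (subst (NoConsecutive R) e nc)) (fromSplits ks)
  where
  tail : ∀ k ks → NoConsecutive R (k ∷ ks) → NoConsecutive R ks
  tail k []           _        = tt
  tail k (a ∷ [])     _        = tt
  tail k (a ∷ b ∷ ks) (_ , nc) = nc
  splits : ∀ ls a b c hs → NoConsecutive R (ls ++ a ∷ b ∷ c ∷ hs) → ¬ R c b a
  splits []       a b c hs (¬r , _) = ¬r
  splits (l ∷ ls) a b c hs nc       = splits ls a b c hs (tail l (ls ++ a ∷ b ∷ c ∷ hs) nc)
  fromSplits : ∀ ks → (∀ ls a b c hs → ks ≡ ls ++ a ∷ b ∷ c ∷ hs → ¬ R c b a) → NoConsecutive R ks
  fromSplits []               _  = tt
  fromSplits (a ∷ [])         _  = tt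
  fromSplits (a ∷ b ∷ [])     _  = tt
  fromSplits (a ∷ b ∷ c ∷ ks) sp =
    sp [] a b c ks refl ,
    fromSplits (b ∷ c ∷ ks) (λ ls a′ b′ c′ hs e → sp (a ∷ ls) a′ b′ c′ hs (cong (a ∷_) e))

reverse-split : ∀ (ls : List ℕ) a b c hs →
                reverse (ls ++ a ∷ b ∷ c ∷ hs) ≡ reverse hs ++ c ∷ b ∷ a ∷ reverse ls
reverse-split ls a b c hs = begin
  reverse (ls ++ a ∷ b ∷ c ∷ hs)                ≡⟨ reverse-++ ls (a ∷ b ∷ c ∷ hs) ⟩
  reverse ((a ∷ b ∷ c ∷ []) ++ hs) ++ reverse ls ≡⟨ cong (_++ reverse ls) (reverse-++ (a ∷ b ∷ c ∷ []) hs) ⟩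
  (reverse hs ++ c ∷ b ∷ a ∷ []) ++ reverse ls   ≡⟨ ++-assoc (reverse hs) (c ∷ b ∷ a ∷ []) (reverse ls) ⟩
  reverse hs ++ c ∷ b ∷ a ∷ reverse ls           ∎
  where open ≡-Reasoning

NoConsecutive-reverse⁺ : ∀ {R R′} → (∀ {a b c} → R′ a b c → R c b a) →
                         ∀ ks → NoConsecutive R ks → NoConsecutive R′ (reverse ks)
NoConsecutive-reverse⁺ {R} {R′} R′⇒R ks nc = from (NoConsecutive⇔splits R′ (reverse ks)) λ ls a b c hs e r →
  to (NoConsecutive⇔splits R ks) nc (reverse hs) c b a (reverse ls)
    (trans (sym (reverse-involutive ks)) (trans (cong reverse e) (reverse-split ls a b c hs))) (R′⇒R r)

NoConsecutive-reverse : ∀ {R R′} → (∀ {a b c} → R′ a b c ⇔ R c b a) →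
                        ∀ ks → NoConsecutive R ks ⇔ NoConsecutive R′ (reverse ks)
NoConsecutive-reverse R′⇔R ks = mk⇔ (NoConsecutive-reverse⁺ (to R′⇔R) ks)
  (subst (NoConsecutive _) (reverse-involutive ks) ∘ NoConsecutive-reverse⁺ (from R′⇔R) (reverse ks))

NoConsecutive-map : ∀ {R R′} (g : ℕ → ℕ) ks →
                    (∀ {a b c} → a ∈ ks → b ∈ ks → c ∈ ks → R′ (g c) (g b) (g a) ⇔ R c b a) →
                    NoConsecutive R ks ⇔ NoConsecutive R′ (map g ks)
NoConsecutive-map g []               _ = mk⇔ id id
NoConsecutive-map g (a ∷ [])         _ = mk⇔ id id
NoConsecutive-map g (a ∷ b ∷ [])     _ = mk⇔ id id
NoConsecutive-map g (a ∷ b ∷ c ∷ ks) R′⇔R =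
  mk⇔ (_∘ to triple) (_∘ from triple) ×-⇔
  NoConsecutive-map g (b ∷ c ∷ ks) (λ a∈ b∈ c∈ → R′⇔R (there a∈) (there b∈) (there c∈))
  where triple = R′⇔R (here refl) (there (here refl)) (there (there (here refl)))

Admissible-tail : ∀ {x b bs} → Admissible x (b ∷ bs) → Admissible x bs
Admissible-tail (_ ∷ x<bs , _ ∷ u) = x<bs , u

OccursAt-spine : ∀ s {x a b c rest} → Admissible x (a ∷ b ∷ c ∷ rest) →
                 OccursAt (patternOf s) (spine x (b ∷ c ∷ rest)) a ⇔ InOrder s (minLeaf c) (minLeaf b) (minLeaf a)
OccursAt-spine s {x} {a} {b} {c} {rest} (x<a ∷ x<b ∷ x<c ∷ x<rest , (a≢b ∷ a≢c ∷ _) ∷ (b≢c ∷ _) ∷ _) =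
  subst (λ m → patternOf s ≡ st (comb m (minLeaf c) (minLeaf b) (minLeaf a)) ⇔ _)
        (sym (minLeaf-spine x rest x<rest))
        (occurs⇔InOrder s x<c x<b x<a (≢-sym b≢c) (≢-sym a≢b) (≢-sym a≢c))

module _ (s : Shape) where
  private P = patternOf s

  NoOccurrence-spine⁻ : ∀ {x} bs → Admissible x bs → NoOccurrence P (spine x bs) →
                        All (NoOccurrence P) bs × NoConsecutive (InOrder s) (map minLeaf bs)
  NoOccurrence-spine⁻ []                 _  _                 = [] , tt
  NoOccurrence-spine⁻ (a ∷ [])           _  (_ , noA , _)     = noA ∷ [] , tt
  NoOccurrence-spine⁻ (a ∷ b ∷ [])       ad (noB , noA , _)   =
    noA ∷ proj₁ (NoOccurrence-spine⁻ (b ∷ []) (Admissible-tail ad) noB) , tt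
  NoOccurrence-spine⁻ (a ∷ b ∷ c ∷ rest) ad (noBC , noA , ¬occ) =
    let noBs , nc = NoOccurrence-spine⁻ (b ∷ c ∷ rest) (Admissible-tail ad) noBC
    in noA ∷ noBs , ¬occ ∘ from (OccursAt-spine s ad) , nc

  NoOccurrence-spine⁺ : ∀ {x} bs → Admissible x bs → All (NoOccurrence P) bs →
                        NoConsecutive (InOrder s) (map minLeaf bs) → NoOccurrence P (spine x bs)
  NoOccurrence-spine⁺ []                 _  _            _         = tt
  NoOccurrence-spine⁺ (a ∷ [])           _  (noA ∷ [])   _         = tt , noA , λ ()
  NoOccurrence-spine⁺ (a ∷ b ∷ [])       ad (noA ∷ noBs) _         =
    NoOccurrence-spine⁺ (b ∷ []) (Admissible-tail ad) noBs tt , noA , λ ()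
  NoOccurrence-spine⁺ (a ∷ b ∷ c ∷ rest) ad (noA ∷ noBs) (¬r , nc) =
    NoOccurrence-spine⁺ (b ∷ c ∷ rest) (Admissible-tail ad) noBs nc , noA , ¬r ∘ to (OccursAt-spine s ad)

-- Rearranging branches

record BranchRearrangement (R R′ : ℕ → ℕ → ℕ → Set) : Set where
  field
    rearrange            : List Tree → List Tree
    rearrange-↭          : ∀ {bs} → Unique (map minLeaf bs) → rearrange bs ↭ bs
    rearrange-involutive : ∀ {bs} → Unique (map minLeaf bs) → rearrange (rearrange bs) ≡ bs
    rearrange-map        : ∀ (f : Tree → Tree) bs → (∀ {b} → b ∈ bs → minLeaf (f b) ≡ minLeaf b) →
                           rearrange (map f bs) ≡ map f (rearrange bs)
    rearrange-NoConsecutive : ∀ {bs} → Unique (map minLeaf bs) →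
                              NoConsecutive R (map minLeaf bs) ⇔ NoConsecutive R′ (map minLeaf (rearrange bs))

module Rearranged {s s′ : Shape} (ρ : BranchRearrangement (InOrder s) (InOrder s′)) where
  open BranchRearrangement ρ

  -- φ-branches T is map φ (branches T), unfolded so that the recursion is structural.
  φ : Tree → Tree
  φ-branches : Tree → List Tree
  φ T = spine (spineLeaf T) (rearrange (φ-branches T))
  φ-branches (leaf _)   = []
  φ-branches (node A B) = φ B ∷ φ-branches A

  φ-spine : ∀ x bs → φ (spine x bs) ≡ spine x (rearrange (map φ bs))
  φ-spine x bs = cong₂ (λ y cs → spine y (rearrange cs)) (spineLeaf-spine x bs)
                       (trans (φ-branches≡ (spine x bs)) (cong (map φ) (branches-spine x bs)))
    where
    φ-branches≡ : ∀ T → φ-branches T ≡ map φ (branches T)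
    φ-branches≡ (leaf _)   = refl
    φ-branches≡ (node A B) = cong (φ B ∷_) (φ-branches≡ A)

  record Faithful (T : Tree) : Set where
    field
      wellLabelled  : WellLabelled (φ T)
      minLeaf-φ     : minLeaf (φ T) ≡ minLeaf T
      leaves-φ      : leaves (φ T) ↭ leaves T
      involutive    : φ (φ T) ≡ T
      noOccurrence⁺ : NoOccurrence (patternOf s) T → NoOccurrence (patternOf s′) (φ T)
      noOccurrence⁻ : NoOccurrence (patternOf s′) (φ T) → NoOccurrence (patternOf s) T
  open Faithful

  concatMap-leaves-φ : ∀ {bs} → All Faithful bs → concatMap leaves (map φ bs) ↭ concatMap leaves bs
  concatMap-leaves-φ []         = ↭-refl
  concatMap-leaves-φ (fb ∷ fbs) = Perm.++⁺ (leaves-φ fb) (concatMap-leaves-φ fbs)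

  module _ {bs : List Tree} (fbs : All Faithful bs) where
    minLeaves-φ : map minLeaf (map φ bs) ≡ map minLeaf bs
    minLeaves-φ = trans (sym (map-∘ bs)) (map-cong-local (All.map minLeaf-φ fbs))

    involutive-map : map φ (map φ bs) ≡ bs
    involutive-map = trans (sym (map-∘ bs)) (map-id-local (All.map involutive fbs))

    minLeaf-φ-image : ∀ {b} → b ∈ map φ bs → minLeaf (φ b) ≡ minLeaf b
    minLeaf-φ-image b∈ with ∈-map⁻ φ b∈
    ... | c , c∈ , refl = let fc = All.lookup fbs c∈ in trans (cong minLeaf (involutive fc)) (sym (minLeaf-φ fc))

    ProperSpine-φ : ∀ {x} → ProperSpine x bs → ProperSpine x (map φ bs)
    ProperSpine-φ {x} (_ , x<bs , u) =
      All.map⁺ (All.map (proj₁ ∘ wellLabelled) fbs) ,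
      All.map⁺ (All.zipWith (λ (fb , x<b) → subst (x <_) (sym (minLeaf-φ fb)) x<b) (fbs , x<bs)) ,
      Unique-resp-↭ (prep x (↭-sym (concatMap-leaves-φ fbs))) u

  module _ {x bs} (pbs : ProperSpine x bs) (fbs : All Faithful bs) where
    private
      bs′ = rearrange (map φ bs)
      φ-spine-x = φ-spine x bs
      adm = ProperSpine⇒Admissible pbs
      distinct-φ : Unique (map minLeaf (map φ bs))
      distinct-φ = subst Unique (sym (minLeaves-φ fbs)) (proj₂ adm)
      bs′↭ : bs′ ↭ map φ bs
      bs′↭ = rearrange-↭ distinct-φ
      pbs′ : ProperSpine x bs′
      pbs′ = ProperSpine-↭ (↭-sym bs′↭) (ProperSpine-φ fbs pbs)
      adm′ = ProperSpine⇒Admissible pbs′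

    Faithful-spine : Faithful (spine x bs)
    Faithful-spine .wellLabelled =
      subst WellLabelled (sym φ-spine-x) (from (WellLabelled-spine x bs′) pbs′)
    Faithful-spine .minLeaf-φ = begin
      minLeaf (φ (spine x bs)) ≡⟨ cong minLeaf φ-spine-x ⟩
      minLeaf (spine x bs′)    ≡⟨ minLeaf-spine x bs′ (proj₁ adm′) ⟩
      x                        ≡⟨ minLeaf-spine x bs (proj₁ adm) ⟨
      minLeaf (spine x bs)     ∎
      where open ≡-Reasoning
    Faithful-spine .leaves-φ = begin
      leaves (φ (spine x bs))         ≡⟨ cong leaves φ-spine-x ⟩
      leaves (spine x bs′)            ↭⟨ leaves-spine x bs′ ⟩
      x ∷ concatMap leaves bs′        ↭⟨ prep x (concatMap-↭ leaves bs′↭) ⟩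
      x ∷ concatMap leaves (map φ bs) ↭⟨ prep x (concatMap-leaves-φ fbs) ⟩
      x ∷ concatMap leaves bs         ↭⟨ leaves-spine x bs ⟨
      leaves (spine x bs)             ∎
      where open PermutationReasoning
    Faithful-spine .involutive = begin
      φ (φ (spine x bs))                        ≡⟨ cong φ φ-spine-x ⟩
      φ (spine x bs′)                           ≡⟨ φ-spine x bs′ ⟩
      spine x (rearrange (map φ bs′))
        ≡⟨ cong (spine x ∘ rearrange) (rearrange-map φ (map φ bs) (minLeaf-φ-image fbs)) ⟨
      spine x (rearrange (rearrange (map φ (map φ bs))))
        ≡⟨ cong (spine x ∘ rearrange ∘ rearrange) (involutive-map fbs) ⟩
      spine x (rearrange (rearrange bs))
        ≡⟨ cong (spine x) (rearrange-involutive (proj₂ adm)) ⟩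
      spine x bs
        ∎
      where open ≡-Reasoning
    Faithful-spine .noOccurrence⁺ noOcc =
      let noBs , nc = NoOccurrence-spine⁻ s bs adm noOcc
      in subst (NoOccurrence (patternOf s′)) (sym φ-spine-x)
           (NoOccurrence-spine⁺ s′ bs′ adm′
             (All-resp-↭ (↭-sym bs′↭)
               (All.map⁺ (All.zipWith (λ (fb , noB) → noOccurrence⁺ fb noB) (fbs , noBs))))
             (to (rearrange-NoConsecutive distinct-φ) (subst (NoConsecutive (InOrder s)) (sym (minLeaves-φ fbs)) nc)))
    Faithful-spine .noOccurrence⁻ noOcc =
      let noBs′ , nc′ = NoOccurrence-spine⁻ s′ bs′ adm′ (subst (NoOccurrence (patternOf s′)) φ-spine-x noOcc)
      in NoOccurrence-spine⁺ s bs adm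
           (All.zipWith (λ (fb , noB) → noOccurrence⁻ fb noB) (fbs , All.map⁻ (All-resp-↭ bs′↭ noBs′)))
           (subst (NoConsecutive (InOrder s)) (minLeaves-φ fbs) (from (rearrange-NoConsecutive distinct-φ) nc′))

  faithful : ∀ T → WellLabelled T → Faithful T
  faithful-branches : ∀ T → WellLabelled T → All Faithful (branches T)
  faithful T wT =
    subst Faithful (spine-branches T)
      (Faithful-spine (to (WellLabelled-spine _ _) (subst WellLabelled (sym (spine-branches T)) wT))
                      (faithful-branches T wT))
  faithful-branches (leaf _)   _   = []
  faithful-branches (node A B) wAB =
    let wA , wB = WellLabelled-node⁻ wAB in faithful B wB ∷ faithful-branches A wA

  transfer : ∀ {l n} → NumAvoiding (patternOf s) l n → NumAvoiding (patternOf s′) l n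
  transfer {l} = counts-involution φ forward backward (φφ ∘ proj₁) (φφ ∘ proj₁)
    where
    faithfulTree : ∀ {T} → IsTree l T → Faithful T
    faithfulTree {T} t = faithful T (IsTree⇒WellLabelled t)
    φφ : ∀ {T} → IsTree l T → φ (φ T) ≡ T
    φφ = involutive ∘ faithfulTree
    IsTree-φ : ∀ {T} → IsTree l T → IsTree l (φ T)
    IsTree-φ t = proj₁ (wellLabelled (faithfulTree t)) , ↭-trans (leaves-φ (faithfulTree t)) (proj₂ t)
    forward : ∀ {T} → IsTree l T × Avoids (patternOf s) T → IsTree l (φ T) × Avoids (patternOf s′) (φ T)
    forward {T} (t , av) =
      IsTree-φ t ,
      NoOccurrence⇒Avoids (φ T) (patternOf-IsComb s′) (noOccurrence⁺ (faithfulTree t) (Avoids⇒NoOccurrence _ T av))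
    backward : ∀ {T} → IsTree l T × Avoids (patternOf s′) T → IsTree l (φ T) × Avoids (patternOf s) (φ T)
    backward {T} (t , av) =
      IsTree-φ t ,
      NoOccurrence⇒Avoids (φ T) (patternOf-IsComb s)
        (noOccurrence⁻ (faithfulTree (IsTree-φ t))
          (subst (NoOccurrence (patternOf s′)) (sym (φφ t)) (Avoids⇒NoOccurrence _ T av)))

reverseShape : Shape → Shape
reverseShape yzw = wzy
reverseShape ywz = wyz
reverseShape zyw = zwy
reverseShape zwy = zyw
reverseShape wyz = ywz
reverseShape wzy = yzw

InOrder-reverseShape : ∀ s {y z w} → InOrder (reverseShape s) y z w ⇔ InOrder s w z y
InOrder-reverseShape yzw = mk⇔ id id
InOrder-reverseShape ywz = mk⇔ id id
InOrder-reverseShape zyw = mk⇔ id id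
InOrder-reverseShape zwy = mk⇔ id id
InOrder-reverseShape wyz = mk⇔ id id
InOrder-reverseShape wzy = mk⇔ id id

reversal : ∀ s → BranchRearrangement (InOrder s) (InOrder (reverseShape s))
reversal s = record
  { rearrange               = reverse
  ; rearrange-↭             = λ {bs} _ → ↭-reverse bs
  ; rearrange-involutive    = λ {bs} _ → reverse-involutive bs
  ; rearrange-map           = λ f bs _ → sym (reverse-map f bs)
  ; rearrange-NoConsecutive = λ {bs} _ →
      subst (λ ks → NoConsecutive (InOrder s) (map minLeaf bs) ⇔ NoConsecutive (InOrder (reverseShape s)) ks)
            (sym (reverse-map minLeaf bs))
            (NoConsecutive-reverse (InOrder-reverseShape s) (map minLeaf bs))
  }

avoiders-reverseShape : ∀ s {l n} → NumAvoiding (patternOf s) l n → NumAvoiding (patternOf (reverseShape s)) l n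
avoiders-reverseShape s = Rearranged.transfer {s} (reversal s)

-- Mirroring the order of the branch minima

AllPairs-∷ʳ : ∀ {R : A → A → Set} xs {x} → AllPairs R xs → All (λ y → R y x) xs →
              AllPairs R (xs ∷ʳ x)
AllPairs-∷ʳ []       []       []       = [] ∷ []
AllPairs-∷ʳ (y ∷ xs) (r ∷ rs) (p ∷ ps) = All.++⁺ r (p ∷ []) ∷ AllPairs-∷ʳ xs rs ps

AllPairs-reverse : ∀ {R : A → A → Set} xs → AllPairs R xs → AllPairs (λ a b → R b a) (reverse xs)
AllPairs-reverse []       []       = []
AllPairs-reverse (x ∷ xs) (r ∷ rs) rewrite unfold-reverse x xs =
  AllPairs-∷ʳ (reverse xs) (AllPairs-reverse xs rs) (All-resp-↭ (↭-sym (↭-reverse xs)) r)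

zip-∈⁻ : ∀ (as : List A) (bs : List B) {a b} → (a , b) ∈ zip as bs → a ∈ as × b ∈ bs
zip-∈⁻ (a ∷ as) (b ∷ bs) (here refl) = here refl , here refl
zip-∈⁻ (a ∷ as) (b ∷ bs) (there p)   = let a∈ , b∈ = zip-∈⁻ as bs p in there a∈ , there b∈

zip-∈-swap : ∀ (as : List A) (bs : List B) {a b} → (a , b) ∈ zip as bs → (b , a) ∈ zip bs as
zip-∈-swap (a ∷ as) (b ∷ bs) (here refl) = here refl
zip-∈-swap (a ∷ as) (b ∷ bs) (there p)   = there (zip-∈-swap as bs p)

map-proj₁-zip : ∀ (as : List A) (bs : List B) → length as ≡ length bs → map proj₁ (zip as bs) ≡ as
map-proj₁-zip []       []       _ = refl
map-proj₁-zip (a ∷ as) (b ∷ bs) e = cong (a ∷_) (map-proj₁-zip as bs (suc-injective e))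

zip-∷ʳ : ∀ (as : List A) (bs : List B) a b → length as ≡ length bs →
         zip (as ∷ʳ a) (bs ∷ʳ b) ≡ zip as bs ∷ʳ (a , b)
zip-∷ʳ []        []        a b _ = refl
zip-∷ʳ (a′ ∷ as) (b′ ∷ bs) a b e = cong ((a′ , b′) ∷_) (zip-∷ʳ as bs a b (suc-injective e))

reverse-zip : ∀ (as : List A) (bs : List B) → length as ≡ length bs →
              reverse (zip as bs) ≡ zip (reverse as) (reverse bs)
reverse-zip []       []       _ = refl
reverse-zip (a ∷ as) (b ∷ bs) e = begin
  reverse ((a , b) ∷ zip as bs)               ≡⟨ unfold-reverse (a , b) (zip as bs) ⟩
  reverse (zip as bs) ∷ʳ (a , b)              ≡⟨ cong (_∷ʳ (a , b)) (reverse-zip as bs (suc-injective e)) ⟩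
  zip (reverse as) (reverse bs) ∷ʳ (a , b)    ≡⟨ zip-∷ʳ (reverse as) (reverse bs) a b lengths ⟨
  zip (reverse as ∷ʳ a) (reverse bs ∷ʳ b)     ≡⟨ cong₂ zip (unfold-reverse a as) (unfold-reverse b bs) ⟨
  zip (reverse (a ∷ as)) (reverse (b ∷ bs))   ∎
  where
  open ≡-Reasoning
  lengths = trans (length-reverse as) (trans (suc-injective e) (sym (length-reverse bs)))

zip-antitone : ∀ {as bs : List ℕ} → AllPairs _<_ as → AllPairs (λ u v → v < u) bs →
               ∀ {a b a′ b′} → (a , b) ∈ zip as bs → (a′ , b′) ∈ zip as bs → a < a′ → b′ < b
zip-antitone {_ ∷ as} {_ ∷ bs} _         _        (here refl) (here refl) a<a  =
  contradiction a<a (<-irrefl refl)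
zip-antitone {_ ∷ as} {_ ∷ bs} _         (b> ∷ _) (here refl) (there q)   _    =
  All.lookup b> (proj₂ (zip-∈⁻ as bs q))
zip-antitone {_ ∷ as} {_ ∷ bs} (a< ∷ _)  _        (there p)   (here refl) a<a′ =
  contradiction (All.lookup a< (proj₁ (zip-∈⁻ as bs p))) (<-asym a<a′)
zip-antitone {_ ∷ as} {_ ∷ bs} (_ ∷ as↗) (_ ∷ bs↘) (there p)  (there q)   a<a′ =
  zip-antitone as↗ bs↘ p q a<a′

valueAt : List (ℕ × ℕ) → ℕ → ℕ
valueAt []             n = n
valueAt ((a , b) ∷ ps) n with n ≟ a
... | yes _ = b
... | no  _ = valueAt ps n

valueAt-∈ : ∀ ps {n} → n ∈ map proj₁ ps → (n , valueAt ps n) ∈ ps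
valueAt-∈ ((a , b) ∷ ps) {n} n∈ with n ≟ a
valueAt-∈ ((a , b) ∷ ps) n∈          | yes refl = here refl
valueAt-∈ ((a , b) ∷ ps) (here n≡a)  | no  n≢a  = contradiction n≡a n≢a
valueAt-∈ ((a , b) ∷ ps) (there n∈)  | no  _    = there (valueAt-∈ ps n∈)

mirrorPairs : List ℕ → List (ℕ × ℕ)
mirrorPairs s = zip s (reverse s)

module MirrorPairs {s : List ℕ} (s↗ : AllPairs _<_ s) where
  private
    lengths : length s ≡ length (reverse s)
    lengths = sym (length-reverse s)

  pair-∈ : ∀ {n} → n ∈ s → (n , valueAt (mirrorPairs s) n) ∈ mirrorPairs s
  pair-∈ n∈ = valueAt-∈ (mirrorPairs s) (subst (_ ∈_) (sym (map-proj₁-zip s (reverse s) lengths)) n∈)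

  pair-∈ʳ : ∀ {a b} → (a , b) ∈ mirrorPairs s → b ∈ s
  pair-∈ʳ p = Any.reverse⁻ (proj₂ (zip-∈⁻ s (reverse s) p))

  pair-sym : ∀ {a b} → (a , b) ∈ mirrorPairs s → (b , a) ∈ mirrorPairs s
  pair-sym p = Any.reverse⁻ (subst ((_ , _) ∈_) zip-reverse (zip-∈-swap s (reverse s) p))
    where
    zip-reverse : zip (reverse s) s ≡ reverse (mirrorPairs s)
    zip-reverse = trans (cong (zip (reverse s)) (sym (reverse-involutive s))) (sym (reverse-zip s (reverse s) lengths))

  pair-antitone : ∀ {a b a′ b′} → (a , b) ∈ mirrorPairs s → (a′ , b′) ∈ mirrorPairs s → a < a′ → b′ < b
  pair-antitone = zip-antitone s↗ (AllPairs-reverse s s↗)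

  pair-functional : ∀ {a b b′} → (a , b) ∈ mirrorPairs s → (a , b′) ∈ mirrorPairs s → b ≡ b′
  pair-functional {b = b} {b′} p q with <-cmp b b′
  ... | tri< b<b′ _ _ = contradiction (pair-antitone (pair-sym p) (pair-sym q) b<b′) (<-irrefl refl)
  ... | tri≈ _ b≡b′ _ = b≡b′
  ... | tri> _ _ b′<b = contradiction (pair-antitone (pair-sym q) (pair-sym p) b′<b) (<-irrefl refl)

-- The order-reversing permutation of the entries of ks (its behaviour outside ks is irrelevant).
mirror : List ℕ → ℕ → ℕ
mirror ks = valueAt (mirrorPairs (Sort.sort ks))

mirror-↭ : ∀ {ks ks′} → ks ↭ ks′ → mirror ks ≡ mirror ks′
mirror-↭ {ks} {ks′} p = cong (valueAt ∘ mirrorPairs) (Pointwise-≡⇒≡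
  (Sorted.↗↭↗⇒≋ ≤-totalOrder (Sort.sort-↗ ks) (Sort.sort-↗ ks′)
    (↭⇒↭ₛ (↭-trans (Sort.sort-↭ ks) (↭-trans p (↭-sym (Sort.sort-↭ ks′)))))))

AllPairs-≤⇒< : ∀ {ks} → AllPairs _≤_ ks → Unique ks → AllPairs _<_ ks
AllPairs-≤⇒< []       []       = []
AllPairs-≤⇒< (≤s ∷ p) (≢s ∷ u) =
  All.zipWith (λ (m≤n , m≢n) → ≤∧≢⇒< m≤n m≢n) (≤s , ≢s) ∷ AllPairs-≤⇒< p u

module _ {ks : List ℕ} (uks : Unique ks) where
  private
    sorted = Sort.sort ks
    sorted↭ : sorted ↭ ks
    sorted↭ = Sort.sort-↭ ks
    sorted↗ : AllPairs _<_ sorted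
    sorted↗ = AllPairs-≤⇒< (Sorted.Sorted⇒AllPairs ≤-totalOrder (Sort.sort-↗ ks))
                           (Unique-resp-↭ (↭-sym sorted↭) uks)
    open MirrorPairs sorted↗
    pair : ∀ {n} → n ∈ ks → (n , mirror ks n) ∈ mirrorPairs sorted
    pair = pair-∈ ∘ ∈-resp-↭ (↭-sym sorted↭)

  mirror-∈ : ∀ {n} → n ∈ ks → mirror ks n ∈ ks
  mirror-∈ = ∈-resp-↭ sorted↭ ∘ pair-∈ʳ ∘ pair

  mirror-involutive : ∀ {n} → n ∈ ks → mirror ks (mirror ks n) ≡ n
  mirror-involutive n∈ = pair-functional (pair (mirror-∈ n∈)) (pair-sym (pair n∈))

  mirror-antitone : ∀ {a b} → a ∈ ks → b ∈ ks → mirror ks b < mirror ks a ⇔ a < b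
  mirror-antitone {a} {b} a∈ b∈ = mk⇔ reflects (pair-antitone (pair a∈) (pair b∈))
    where
    reflects : mirror ks b < mirror ks a → a < b
    reflects mb<ma with <-cmp a b
    ... | tri< a<b _ _  = a<b
    ... | tri≈ _ refl _ = contradiction mb<ma (<-irrefl refl)
    ... | tri> _ _ b<a  = contradiction (pair-antitone (pair b∈) (pair a∈) b<a) (<-asym mb<ma)

module ByKey {A : Set} (key : A → ℕ) where
  withKey : List A → ℕ → A → A
  withKey []       n d = d
  withKey (a ∷ as) n d with key a ≟ n
  ... | yes _ = a
  ... | no  _ = withKey as n d

  withKey-spec : ∀ as {n} d → n ∈ map key as → withKey as n d ∈ as × key (withKey as n d) ≡ n
  withKey-spec (a ∷ as) {n} d n∈ with key a ≟ n
  withKey-spec (a ∷ as) d n∈         | yes ka≡n = here refl , ka≡n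
  withKey-spec (a ∷ as) d (here n≡ka) | no  ka≢n = contradiction (sym n≡ka) ka≢n
  withKey-spec (a ∷ as) d (there n∈)  | no  _    = let a∈ , e = withKey-spec as d n∈ in there a∈ , e

  withKey-key : ∀ as {a} d → Unique (map key as) → a ∈ as → withKey as (key a) d ≡ a
  withKey-key (a ∷ as) {a′} d (ka∉ ∷ u) a′∈ with key a ≟ key a′
  withKey-key (a ∷ as) d (ka∉ ∷ u) (here refl) | yes _    = refl
  withKey-key (a ∷ as) d (ka∉ ∷ u) (there a′∈) | yes ka≡  = contradiction ka≡ (All.lookup ka∉ (∈-map⁺ key a′∈))
  withKey-key (a ∷ as) d (ka∉ ∷ u) (here refl) | no  ka≢  = contradiction refl ka≢
  withKey-key (a ∷ as) d (ka∉ ∷ u) (there a′∈) | no  _    = withKey-key as d u a′∈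

  withKey-map : ∀ (f : A → A) as n d → (∀ {a} → a ∈ as → key (f a) ≡ key a) →
                withKey (map f as) n (f d) ≡ f (withKey as n d)
  withKey-map f []       n d _    = refl
  withKey-map f (a ∷ as) n d keep with key (f a) ≟ n | key a ≟ n
  ... | yes _    | yes _    = refl
  ... | yes kfa≡ | no  ka≢  = contradiction (trans (sym (keep (here refl))) kfa≡) ka≢
  ... | no  kfa≢ | yes ka≡  = contradiction (trans (keep (here refl)) ka≡) kfa≢
  ... | no  _    | no  _    = withKey-map f as n d (keep ∘ there)

  mirrorPartner : List A → A → A
  mirrorPartner as a = withKey as (mirror (map key as) (key a)) a

  mirrorByKey : List A → List A
  mirrorByKey as = map (mirrorPartner as) as

  keys-map : ∀ (f : A → A) as → (∀ {a} → a ∈ as → key (f a) ≡ key a) → map key (map f as) ≡ map key as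
  keys-map f as keep = trans (sym (map-∘ as)) (map-cong-local (All.tabulate keep))

  mirrorByKey-map : ∀ (f : A → A) as → (∀ {a} → a ∈ as → key (f a) ≡ key a) →
                    mirrorByKey (map f as) ≡ map f (mirrorByKey as)
  mirrorByKey-map f as keep = begin
    map (mirrorPartner (map f as)) (map f as) ≡⟨ map-∘ as ⟨
    map (mirrorPartner (map f as) ∘ f) as     ≡⟨ map-cong-local (All.tabulate partner-f) ⟩
    map (f ∘ mirrorPartner as) as             ≡⟨ map-∘ as ⟩
    map f (mirrorByKey as)                    ∎
    where
    open ≡-Reasoning
    partner-f : ∀ {a} → a ∈ as → mirrorPartner (map f as) (f a) ≡ f (mirrorPartner as a)
    partner-f {a} a∈ =
      trans (cong₂ (λ ks k → withKey (map f as) (mirror ks k) (f a)) (keys-map f as keep) (keep a∈))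
            (withKey-map f as _ a keep)

  module _ {as : List A} (u : Unique (map key as)) where
    private
      ks = map key as
      partner-spec : ∀ {a} → a ∈ as → mirrorPartner as a ∈ as × key (mirrorPartner as a) ≡ mirror ks (key a)
      partner-spec a∈ = withKey-spec as _ (mirror-∈ u (∈-map⁺ key a∈))
      withKey-mirror : ∀ bs d {a} → Unique (map key bs) → a ∈ bs → a ∈ as →
                       withKey bs (mirror ks (key (mirrorPartner as a))) d ≡ a
      withKey-mirror bs d {a} ubs a∈bs a∈ = begin
        withKey bs (mirror ks (key (mirrorPartner as a))) d
          ≡⟨ cong (λ k → withKey bs (mirror ks k) d) (proj₂ (partner-spec a∈)) ⟩
        withKey bs (mirror ks (mirror ks (key a))) d
          ≡⟨ cong (λ k → withKey bs k d) (mirror-involutive u (∈-map⁺ key a∈)) ⟩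
        withKey bs (key a) d
          ≡⟨ withKey-key bs d ubs a∈bs ⟩
        a ∎
        where open ≡-Reasoning
      partner-involutive : ∀ {a} → a ∈ as → mirrorPartner as (mirrorPartner as a) ≡ a
      partner-involutive a∈ = withKey-mirror as _ u a∈ a∈

    mirrorByKey-keys : map key (mirrorByKey as) ≡ map (mirror ks) ks
    mirrorByKey-keys =
      trans (sym (map-∘ as)) (trans (map-cong-local (All.tabulate (proj₂ ∘ partner-spec))) (map-∘ as))

    mirrorByKey-↭ : mirrorByKey as ↭ as
    mirrorByKey-↭ = ∼bag⇒↭ (unique∧set⇒bag
      (Unique-map⁺-on _ (Unique.map⁻ u) λ a∈ b∈ e →
        trans (sym (partner-involutive a∈)) (trans (cong (mirrorPartner as) e) (partner-involutive b∈)))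
      (Unique.map⁻ u)
      (mk⇔ (λ b∈ → let a , a∈ , b≡ = ∈-map⁻ _ b∈ in subst (_∈ as) (sym b≡) (proj₁ (partner-spec a∈)))
           (λ a∈ → subst (_∈ mirrorByKey as) (partner-involutive a∈) (∈-map⁺ _ (proj₁ (partner-spec a∈))))))

    mirrorByKey-involutive : mirrorByKey (mirrorByKey as) ≡ as
    mirrorByKey-involutive = trans (sym (map-∘ as)) (map-id-local (All.tabulate partner-partner))
      where
      as′ = mirrorByKey as
      partner-partner : ∀ {a} → a ∈ as → mirrorPartner as′ (mirrorPartner as a) ≡ a
      partner-partner {a} a∈ =
        trans (cong (λ m → withKey as′ (m (key (mirrorPartner as a))) (mirrorPartner as a))
                    (mirror-↭ (Perm.map⁺ key mirrorByKey-↭)))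
              (withKey-mirror as′ _ (Unique-resp-↭ (Perm.map⁺ key (↭-sym mirrorByKey-↭)) u)
                              (∈-resp-↭ (↭-sym mirrorByKey-↭) a∈) a∈)

complementShape : Shape → Shape
complementShape yzw = wzy
complementShape ywz = zwy
complementShape zyw = wyz
complementShape zwy = ywz
complementShape wyz = zyw
complementShape wzy = yzw

×-swap-⇔ : ∀ {A A′ B B′ : Set} → A ⇔ A′ → B ⇔ B′ → (A × B) ⇔ (B′ × A′)
×-swap-⇔ A⇔A′ B⇔B′ =
  mk⇔ (λ (a , b) → to B⇔B′ b , to A⇔A′ a) (λ (b′ , a′) → from A⇔A′ a′ , from B⇔B′ b′)

module _ {y z w : ℕ} (g : ℕ → ℕ)
         (anti : ∀ {a b} → a ∈ y ∷ z ∷ w ∷ [] → b ∈ y ∷ z ∷ w ∷ [] → g b < g a ⇔ a < b) where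
  private
    y∈ : y ∈ y ∷ z ∷ w ∷ []
    y∈ = here refl
    z∈ : z ∈ y ∷ z ∷ w ∷ []
    z∈ = there (here refl)
    w∈ : w ∈ y ∷ z ∷ w ∷ []
    w∈ = there (there (here refl))

  InOrder-complementShape : ∀ s → InOrder (complementShape s) (g y) (g z) (g w) ⇔ InOrder s y z w
  InOrder-complementShape yzw = ×-swap-⇔ (anti z∈ w∈) (anti y∈ z∈)
  InOrder-complementShape ywz = ×-swap-⇔ (anti w∈ z∈) (anti y∈ w∈)
  InOrder-complementShape zyw = ×-swap-⇔ (anti y∈ w∈) (anti z∈ y∈)
  InOrder-complementShape zwy = ×-swap-⇔ (anti w∈ y∈) (anti z∈ w∈)
  InOrder-complementShape wyz = ×-swap-⇔ (anti y∈ z∈) (anti w∈ y∈)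
  InOrder-complementShape wzy = ×-swap-⇔ (anti z∈ y∈) (anti w∈ z∈)

complement : ∀ s → BranchRearrangement (InOrder s) (InOrder (complementShape s))
complement s = record
  { rearrange               = mirrorByKey
  ; rearrange-↭             = mirrorByKey-↭
  ; rearrange-involutive    = mirrorByKey-involutive
  ; rearrange-map           = mirrorByKey-map
  ; rearrange-NoConsecutive = λ {bs} u →
      subst (λ ks → NoConsecutive (InOrder s) (map minLeaf bs) ⇔ NoConsecutive (InOrder (complementShape s)) ks)
            (sym (mirrorByKey-keys u))
            (NoConsecutive-map (mirror (map minLeaf bs)) (map minLeaf bs) λ a∈ b∈ c∈ →
              InOrder-complementShape _ (λ p q → mirror-antitone u (All.lookup (c∈ ∷ b∈ ∷ a∈ ∷ []) p)
                                                                   (All.lookup (c∈ ∷ b∈ ∷ a∈ ∷ []) q)) s)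
  }
  where open ByKey minLeaf

avoiders-complementShape : ∀ s {l n} → NumAvoiding (patternOf s) l n → NumAvoiding (patternOf (complementShape s)) l n
avoiders-complementShape s = Rearranged.transfer {s} (complement s)

-- Enumeration

depth : Tree → ℕ
depth (leaf _)   = 0
depth (node A B) = suc (depth A ⊔ depth B)

depth<leaves : ∀ T → depth T < length (leaves T)
depth<leaves (leaf _)   = s≤s z≤n
depth<leaves (node A B) = begin-strict
  suc (depth A ⊔ depth B)                 ≤⟨ s≤s (m⊔n≤m+n (depth A) (depth B)) ⟩
  suc (depth A + depth B)                 <⟨ s≤s (≤-reflexive (sym (+-suc (depth A) (depth B)))) ⟩
  suc (depth A) + suc (depth B)           ≤⟨ +-mono-≤ (depth<leaves A) (depth<leaves B) ⟩
  length (leaves A) + length (leaves B)   ≡⟨ length-++ (leaves A) ⟨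
  length (leaves A ++ leaves B)           ∎
  where open ≤-Reasoning

treesOver : List ℕ → ℕ → List Tree
treesOver L 0       = map leaf L
treesOver L (suc d) = map leaf L ++ concatMap (λ A → map (node A) (treesOver L d)) (treesOver L d)

treesOver-complete : ∀ L T d → depth T ≤ d → All (_∈ L) (leaves T) → T ∈ treesOver L d
treesOver-complete L (leaf x)   0       _       (x∈ ∷ []) = ∈-map⁺ leaf x∈
treesOver-complete L (leaf x)   (suc d) _       (x∈ ∷ []) = ∈-++⁺ˡ (∈-map⁺ leaf x∈)
treesOver-complete L (node A B) (suc d) (s≤s ≤d) labels =
  ∈-++⁺ʳ (map leaf L)
    (∈-concatMap⁺ (λ A → map (node A) (treesOver L d)) (Any.map (λ { refl → ∈-map⁺ (node A) B∈ }) A∈))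
  where
  A∈ = treesOver-complete L A d (m⊔n≤o⇒m≤o (depth A) (depth B) ≤d) (All.++⁻ˡ (leaves A) labels)
  B∈ = treesOver-complete L B d (m⊔n≤o⇒n≤o (depth A) (depth B) ≤d) (All.++⁻ʳ (leaves A) labels)

IsTree⇒∈treesOver : ∀ {l T} → IsTree l T → T ∈ treesOver (map suc (upTo l)) l
IsTree⇒∈treesOver {l} {T} (_ , p) =
  treesOver-complete _ T l (<⇒≤ (subst (depth T <_) #leaves (depth<leaves T))) (All.tabulate (∈-resp-↭ p))
  where #leaves = trans (↭-length p) (trans (length-map suc (upTo l)) (length-upTo l))

Ordered? : ∀ T → Dec (Ordered T)
Ordered? (leaf _)   = yes tt
Ordered? (node A B) = Ordered? A ×-dec Ordered? B ×-dec minLeaf A <? minLeaf B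

IsTree? : ∀ l T → Dec (IsTree l T)
IsTree? l T = Ordered? T ×-dec ↭-decidable _≟_ (leaves T) (map suc (upTo l))

OccursAt? : ∀ P A B → Dec (OccursAt P A B)
OccursAt? P (node (node X Y) Z) W = P ≟ᵀ st (comb (minLeaf X) (minLeaf Y) (minLeaf Z) (minLeaf W))
OccursAt? P (leaf _)            _ = no id
OccursAt? P (node (leaf _) _)   _ = no id

NoOccurrence? : ∀ P T → Dec (NoOccurrence P T)
NoOccurrence? P (leaf _)   = yes tt
NoOccurrence? P (node A B) = NoOccurrence? P A ×-dec NoOccurrence? P B ×-dec ¬? (OccursAt? P A B)

avoidersCount : ∀ s l → ∃ (NumAvoiding (patternOf s) l)
avoidersCount s l = counts-decidable _≟ᵀ_ avoider? (treesOver (map suc (upTo l)) l) (IsTree⇒∈treesOver ∘ proj₁)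
  where
  avoider? : ∀ T → Dec (IsTree l T × Avoids (patternOf s) T)
  avoider? T = IsTree? l T ×-dec
    map′ (NoOccurrence⇒Avoids T (patternOf-IsComb s)) (Avoids⇒NoOccurrence _ T) (NoOccurrence? _ T)

mainTheorem12 : ∀ P Q → P ∈ patterns → Q ∈ patterns → WilfEquivalent P Q
mainTheorem12 P Q P∈ Q∈ l = n , count P∈ , count Q∈
  where
  n = proj₁ (avoidersCount ywz l)
  count₁ : NumAvoiding p₁ l n
  count₁ = proj₂ (avoidersCount ywz l)
  count₄ : NumAvoiding p₄ l n
  count₄ = avoiders-complementShape ywz count₁
  count : ∀ {R} → R ∈ patterns → NumAvoiding R l n
  count (here refl)                         = count₁
  count (there (here refl))                 = avoiders-reverseShape zwy count₄
  count (there (there (here refl)))         = avoiders-reverseShape ywz count₁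
  count (there (there (there (here refl)))) = count₄
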